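{- Let $(X,\leq,R)$ be a $\Box$-frame. Then $R = ({\leq}\circ R\circ{\leq})$ and $({\leq}^{ -1}\circ R)\subseteq(R\circ{\leq}^{ -1})$.
   Context: For relations $R_1,R_2$ on $X$, $R_1\circ R_2=\{(x,z)\mid\exists y,\ xR_1y \text{ and } yR_2z\}$; ${\leq}^{ -1}$ is the converse of $\leq$. An I-frame is an implicative meet-semilattice with top $\top$, viewed as poset $(X,\leq)$. A $\Box$-frame is $(X,\leq,R)$ with $(X,\leq)$ an I-frame and $R\subseteq X\times X$ such that (B1) $\top Rx$ iff $x=\top$, and $xR\top$ for all $x$; (B2) $xRy$ and $y\leq z$ imply $xRz$; (B3) $xRy$ and $x'Ry'$ imply $(x\wedge x')R(y\wedge y')$; (B4) if $(x\wedge x')Rz$ then there are $y,y'$ with $xRy$, $x'Ry'$ and $y\wedge y'=z$. -}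

module Defs where

open import Level using (Level; _⊔_; suc)
open import Data.Product using (Σ; ∃; _×_; _,_)
open import Relation.Binary.PropositionalEquality using (_≡_)
open import Relation.Binary.Core using (Rel)
open import Relation.Binary.Structures using (IsPartialOrder)

_∘ᴿ_ : ∀ {a ℓ₁ ℓ₂} {X : Set a} → Rel X ℓ₁ → Rel X ℓ₂ → Rel X (a ⊔ ℓ₁ ⊔ ℓ₂)
(R₁ ∘ᴿ R₂) x z = ∃ λ y → R₁ x y × R₂ y z

_⁻¹ᴿ : ∀ {a ℓ} {X : Set a} → Rel X ℓ → Rel X ℓ
(R ⁻¹ᴿ) x y = R y x

_⊆ᴿ_ : ∀ {a ℓ₁ ℓ₂} {X : Set a} → Rel X ℓ₁ → Rel X ℓ₂ → Set (a ⊔ ℓ₁ ⊔ ℓ₂)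
R₁ ⊆ᴿ R₂ = ∀ {x y} → R₁ x y → R₂ x y

_≐ᴿ_ : ∀ {a ℓ₁ ℓ₂} {X : Set a} → Rel X ℓ₁ → Rel X ℓ₂ → Set (a ⊔ ℓ₁ ⊔ ℓ₂)
R₁ ≐ᴿ R₂ = (R₁ ⊆ᴿ R₂) × (R₂ ⊆ᴿ R₁)

-- An I-frame: an implicative meet-semilattice with top, viewed as a poset
-- (X, ≤) whose equality is propositional equality on the carrier.
record IFrame (a ℓ : Level) : Set (suc (a ⊔ ℓ)) where
  infix 4 _≤_
  infixr 7 _∧_
  infixr 5 _⇒_
  field
    X : Set a
    _≤_ : Rel X ℓ
    isPartialOrder : IsPartialOrder _≡_ _≤_
    ⊤ : X
    _∧_ : X → X → X
    _⇒_ : X → X → X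
    ≤-⊤ : ∀ x → x ≤ ⊤
    ∧-lb₁ : ∀ x y → x ∧ y ≤ x
    ∧-lb₂ : ∀ x y → x ∧ y ≤ y
    ∧-glb : ∀ {x y z} → z ≤ x → z ≤ y → z ≤ x ∧ y
    ⇒-adj₁ : ∀ {x y z} → z ∧ x ≤ y → z ≤ x ⇒ y
    ⇒-adj₂ : ∀ {x y z} → z ≤ x ⇒ y → z ∧ x ≤ y

record BoxFrame (a ℓ r : Level) : Set (suc (a ⊔ ℓ ⊔ r)) where
  field
    iframe : IFrame a ℓ
  open IFrame iframe public
  field
    R : Rel X r
    B1a : ∀ x → R ⊤ x → x ≡ ⊤
    B1b : R ⊤ ⊤
    B1c : ∀ x → R x ⊤
    B2 : ∀ {x y z} → R x y → y ≤ z → R x z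
    B3 : ∀ {x x' y y'} → R x y → R x' y' → R (x ∧ x') (y ∧ y')
    B4 : ∀ {x x' z} → R (x ∧ x') z →
         Σ X λ y → Σ X λ y' → R x y × R x' y' × (y ∧ y' ≡ z)

{-# OPTIONS --safe #-}
-- Left antitonicity of R comes from (B3) applied with x R ⊤ and x' R y: this gives
-- (x ∧ x') R (⊤ ∧ y), which is x R y when x ≤ x'. Together with (B2) this absorbs the
-- order on both sides of R. For the second inclusion, y ≤ x turns y R z into
-- (y ∧ x) R z, and (B4) splits z as u ∧ u' with x R u'; then u' ≥ z is the witness.
module Submission where

open import Defs
open import Data.Product using (_×_; _,_)
open import Relation.Binary.PropositionalEquality using (_≡_; subst; sym)
open import Relation.Binary.Structures using (IsPartialOrder)

module IFrameProperties {a ℓ} (I : IFrame a ℓ) where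
  open IFrame I
  open IsPartialOrder isPartialOrder using (antisym; refl)

  ∧-absorbs-≥ : ∀ {x y} → x ≤ y → x ∧ y ≡ x
  ∧-absorbs-≥ x≤y = antisym (∧-lb₁ _ _) (∧-glb refl x≤y)

  ∧-identityˡ : ∀ y → ⊤ ∧ y ≡ y
  ∧-identityˡ y = antisym (∧-lb₂ _ _) (∧-glb (≤-⊤ y) refl)

module BoxFrameProperties {a ℓ r} (F : BoxFrame a ℓ r) where
  open BoxFrame F
  open IsPartialOrder isPartialOrder using (refl)
  open IFrameProperties iframe

  R-antitoneˡ : ∀ {x x' y} → x ≤ x' → R x' y → R x y
  R-antitoneˡ {x} {x'} {y} x≤x' x'Ry =
    subst (λ w → R w y) (∧-absorbs-≥ x≤x')
      (subst (R (x ∧ x')) (∧-identityˡ y) (B3 (B1c x) x'Ry))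

  R-≐-≤∘R∘≤ : R ≐ᴿ ((_≤_ ∘ᴿ R) ∘ᴿ _≤_)
  R-≐-≤∘R∘≤ = (λ {x} {y} xRy → y , (x , refl , xRy) , refl)
            , (λ { (y , (x' , x≤x' , x'Ry) , y≤z) → B2 (R-antitoneˡ x≤x' x'Ry) y≤z })

  ≥∘R⊆R∘≥ : ((_≤_ ⁻¹ᴿ) ∘ᴿ R) ⊆ᴿ (R ∘ᴿ (_≤_ ⁻¹ᴿ))
  ≥∘R⊆R∘≥ {x} {z} (y , y≤x , yRz) with B4 (subst (λ w → R w z) (sym (∧-absorbs-≥ y≤x)) yRz)
  ... | u , u' , _ , xRu' , u∧u'≡z = u' , xRu' , subst (_≤ u') u∧u'≡z (∧-lb₂ u u')

proposition6p1 : ∀ {a ℓ r} (F : BoxFrame a ℓ r) →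
    let open BoxFrame F in
    (R ≐ᴿ ((_≤_ ∘ᴿ R) ∘ᴿ _≤_)) × (((_≤_ ⁻¹ᴿ) ∘ᴿ R) ⊆ᴿ (R ∘ᴿ (_≤_ ⁻¹ᴿ)))
proposition6p1 F = R-≐-≤∘R∘≤ , ≥∘R⊆R∘≥
  where open BoxFrameProperties F
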